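{- For every integer $x\ge 1$, $$3S_{3,0}(x)-S_{3,0}(4x)=S_{3,0}(x)+S_{3,1}(x)+S_{3,2}(x).$$
   Context: For an integer $b\ge 2$ and integer $r\ge 0$, $s_b(r)$ denotes the sum of the digits of $r$ in base $b$. For integers $n\ge 3$, $0\le j\le n-1$ and $x\ge 0$, define $$S_{n,j}(x)=\sum_{0\le r<x,\; r\equiv j \pmod n}(-1)^{s_{n-1}(r)}.$$ -}

module Defs where

open import Data.Nat using (ℕ; zero; suc; _+_; _*_; _∸_; NonZero)
open import Data.Nat.DivMod using (_/_; _%_)
open import Data.Nat.Properties using (_≟_)
open import Data.Integer using (ℤ; +_; -_) renaming (_+_ to _+ℤ_)
open import Relation.Nullary using (yes; no)

-- Digit sum of r in base b, with a fuel parameter (fuel ≥ r suffices for b ≥ 2).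
digitSumFuel : (b : ℕ) → .{{NonZero b}} → ℕ → ℕ → ℕ
digitSumFuel b zero    r = 0
digitSumFuel b (suc f) zero = 0
digitSumFuel b (suc f) r@(suc _) = r % b + digitSumFuel b f (r / b)

s : (b : ℕ) → .{{NonZero b}} → ℕ → ℕ
s b r = digitSumFuel b r r

negOnePow : ℕ → ℤ
negOnePow zero = + 1
negOnePow (suc k) = - negOnePow k

-- S_{n,j}(x) = Σ_{0 ≤ r < x, r ≡ j (mod n)} (-1)^{s_{n-1}(r)},  for n ≥ 3 (here n = suc (suc m), base n-1 = suc m ≥ 2).
S : (n : ℕ) → .{{NonZero n}} → (base : ℕ) → .{{NonZero base}} → ℕ → ℕ → ℤ
S n base j zero = + 0
S n base j (suc x) with x % n ≟ j
... | yes _ = S n base j x +ℤ negOnePow (s base x)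
... | no  _ = S n base j x

Snj : (m : ℕ) → ℕ → ℕ → ℤ
Snj m j x = S (suc (suc m)) (suc m) j x

module Submission where

open import Defs
open import Data.Nat using (ℕ; _≥_) renaming (_*_ to _*ℕ_)
open import Data.Integer using (ℤ; +_; _+_; _*_; _-_)
open import Relation.Binary.PropositionalEquality using (_≡_)

open import Data.Nat using (zero; suc; _≤_; _<_; z≤n; s≤s; z<s; s<s; NonZero) renaming (_+_ to _+ℕ_)
open import Data.Nat.Properties using (≤-refl; ≤-trans; <⇒≤pred; _≟_; *-comm)
open import Data.Nat.DivMod
  using (_/_; _%_; m/n<m; m%n<n; [m+kn]%n≡m%n; m<n⇒m%n≡m; m<n⇒m/n≡0; m*n/n≡m;
         +-distrib-/-∣ʳ; m≡m%n+[m/n]*n)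
open import Data.Nat.Divisibility using (n∣m*n)
open import Data.Integer using (-_)
open import Data.Integer.Properties using (*-identityˡ; +-identityʳ; neg-distribˡ-*)
open import Relation.Binary.PropositionalEquality using (refl; sym; trans; cong; cong₂; module ≡-Reasoning)
open import Relation.Nullary using (yes; no)
import Data.Nat.Tactic.RingSolver as ℕ-Ring
import Data.Integer.Tactic.RingSolver as ℤ-Ring

-- Write t(r) = (-1)^{s₂(r)} for the Thue–Morse sign.  Since
-- the base-2 digits of 4x + k (k < 4) are those of x followed by those of k,
-- t(4x + k) = t(k) t(x), so the block 4x, …, 4x+3 carries the signs
-- t(x)·(+1, -1, -1, +1); and since 4 ≡ 1 (mod 3) its residues are
-- x, x+1, x+2, x (mod 3).  Summing this block over the class 0 (mod 3)
-- contributes 2[x ≡ 0] t(x) - [x ≡ 1] t(x) - [x ≡ 2] t(x), which by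
-- induction on x gives the key identity
--     S_{3,0}(4x) = 2 S_{3,0}(x) - S_{3,1}(x) - S_{3,2}(x),
-- from which the theorem is immediate.

module DigitSum (k : ℕ) where

  b : ℕ
  b = suc (suc k)

  quotient-below : ∀ r f → r ≤ f → suc r / b ≤ f
  quotient-below r f r≤f = ≤-trans (<⇒≤pred (m/n<m (suc r) b (s≤s (s≤s z≤n)))) r≤f

  fuel-irrelevant : ∀ f g r → r ≤ f → r ≤ g → digitSumFuel b f r ≡ digitSumFuel b g r
  fuel-irrelevant zero    zero    zero    _         _         = refl
  fuel-irrelevant zero    (suc g) zero    _         _         = refl
  fuel-irrelevant (suc f) zero    zero    _         _         = refl
  fuel-irrelevant (suc f) (suc g) zero    _         _         = refl
  fuel-irrelevant (suc f) (suc g) (suc r) (s≤s r≤f) (s≤s r≤g) =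
    cong (suc r % b +ℕ_)
      (fuel-irrelevant f g (suc r / b) (quotient-below r f r≤f) (quotient-below r g r≤g))

  s-unfold : ∀ n → s b n ≡ n % b +ℕ s b (n / b)
  s-unfold zero    = refl
  s-unfold (suc r) = cong (suc r % b +ℕ_)
    (fuel-irrelevant r (suc r / b) (suc r / b) (quotient-below r r ≤-refl) ≤-refl)

  s-append : ∀ d q → d < b → s b (d +ℕ q *ℕ b) ≡ d +ℕ s b q
  s-append d q d<b = begin
    s b (d +ℕ q *ℕ b)                             ≡⟨ s-unfold (d +ℕ q *ℕ b) ⟩
    (d +ℕ q *ℕ b) % b +ℕ s b ((d +ℕ q *ℕ b) / b)  ≡⟨ cong₂ (λ m n → m +ℕ s b n) last-digit rest ⟩
    d +ℕ s b q                                    ∎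
    where
    open ≡-Reasoning
    last-digit : (d +ℕ q *ℕ b) % b ≡ d
    last-digit = trans ([m+kn]%n≡m%n d q b) (m<n⇒m%n≡m d<b)
    rest : (d +ℕ q *ℕ b) / b ≡ q
    rest = trans (+-distrib-/-∣ʳ d (n∣m*n q)) (cong₂ _+ℕ_ (m<n⇒m/n≡0 d<b) (m*n/n≡m q b))

  s-append₂ : ∀ d e q → d < b → e < b → s b ((d +ℕ e *ℕ b) +ℕ q *ℕ (b *ℕ b)) ≡ (d +ℕ e) +ℕ s b q
  s-append₂ d e q d<b e<b = begin
    s b ((d +ℕ e *ℕ b) +ℕ q *ℕ (b *ℕ b))  ≡⟨ cong (s b) (regroup d e q b) ⟩
    s b (d +ℕ (e +ℕ q *ℕ b) *ℕ b)         ≡⟨ s-append d (e +ℕ q *ℕ b) d<b ⟩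
    d +ℕ s b (e +ℕ q *ℕ b)                ≡⟨ cong (d +ℕ_) (s-append e q e<b) ⟩
    d +ℕ (e +ℕ s b q)                     ≡⟨ reassoc d e (s b q) ⟩
    (d +ℕ e) +ℕ s b q                     ∎
    where
    open ≡-Reasoning
    regroup : ∀ d e q b → (d +ℕ e *ℕ b) +ℕ q *ℕ (b *ℕ b) ≡ d +ℕ (e +ℕ q *ℕ b) *ℕ b
    regroup = ℕ-Ring.solve-∀
    reassoc : ∀ d e m → d +ℕ (e +ℕ m) ≡ (d +ℕ e) +ℕ m
    reassoc = ℕ-Ring.solve-∀

open DigitSum 0 using (s-append₂)

negOnePow-+ : ∀ m n → negOnePow (m +ℕ n) ≡ negOnePow m * negOnePow n
negOnePow-+ zero    n = sym (*-identityˡ (negOnePow n))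
negOnePow-+ (suc m) n = trans (cong -_ (negOnePow-+ m n)) (neg-distribˡ-* (negOnePow m) (negOnePow n))

indicator : ℕ → ℕ → ℤ
indicator j c with c ≟ j
... | yes _ = + 1
... | no  _ = + 0

S-suc : ∀ n .{{_ : NonZero n}} base .{{_ : NonZero base}} j x →
        S n base j (suc x) ≡ S n base j x + indicator j (x % n) * negOnePow (s base x)
S-suc n base j x with x % n ≟ j
... | yes _ = cong (λ v → S n base j x + v) (sym (*-identityˡ (negOnePow (s base x))))
... | no  _ = sym (+-identityʳ (S n base j x))

t : ℕ → ℤ
t r = negOnePow (s 2 r)

term : ℕ → ℕ → ℤ
term j r = indicator j (r % 3) * t r

t-low-digits : ∀ d e q → d < 2 → e < 2 → t ((d +ℕ e *ℕ 2) +ℕ q *ℕ 4) ≡ negOnePow (d +ℕ e) * t q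
t-low-digits d e q d<2 e<2 =
  trans (cong negOnePow (s-append₂ d e q d<2 e<2)) (negOnePow-+ (d +ℕ e) (s 2 q))

t-block : ∀ k q → k < 4 → t (k +ℕ q *ℕ 4) ≡ t k * t q
t-block 0 q _ = t-low-digits 0 0 q z<s z<s
t-block 1 q _ = t-low-digits 1 0 q (s<s z<s) z<s
t-block 2 q _ = t-low-digits 0 1 q z<s (s<s z<s)
t-block 3 q _ = t-low-digits 1 1 q (s<s z<s) (s<s z<s)
t-block (suc (suc (suc (suc _)))) q (s≤s (s≤s (s≤s (s≤s ()))))

-- Since 4 ≡ 1 (mod 3), k + 4x lies in the residue class of k + (x mod 3).
residue-of-block : ∀ k x → (k +ℕ x *ℕ 4) % 3 ≡ (k +ℕ x % 3) % 3
residue-of-block k x = trans (cong (_% 3) regroup) ([m+kn]%n≡m%n (k +ℕ x % 3) (x / 3 +ℕ x) 3)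
  where
  open ≡-Reasoning
  split-four : ∀ k x → k +ℕ x *ℕ 4 ≡ k +ℕ (x +ℕ x *ℕ 3)
  split-four = ℕ-Ring.solve-∀
  collect : ∀ k r q x → k +ℕ ((r +ℕ q *ℕ 3) +ℕ x *ℕ 3) ≡ (k +ℕ r) +ℕ (q +ℕ x) *ℕ 3
  collect = ℕ-Ring.solve-∀
  regroup : k +ℕ x *ℕ 4 ≡ (k +ℕ x % 3) +ℕ (x / 3 +ℕ x) *ℕ 3
  regroup = begin
    k +ℕ x *ℕ 4                              ≡⟨ split-four k x ⟩
    k +ℕ (x +ℕ x *ℕ 3)                       ≡⟨ cong (λ y → k +ℕ (y +ℕ x *ℕ 3)) (m≡m%n+[m/n]*n x 3) ⟩
    k +ℕ ((x % 3 +ℕ (x / 3) *ℕ 3) +ℕ x *ℕ 3) ≡⟨ collect k (x % 3) (x / 3) x ⟩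
    (k +ℕ x % 3) +ℕ (x / 3 +ℕ x) *ℕ 3        ∎

term-in-block : ∀ j k x → k < 4 → term j (k +ℕ x *ℕ 4) ≡ indicator j ((k +ℕ x % 3) % 3) * (t k * t x)
term-in-block j k x k<4 = cong₂ _*_ (cong (indicator j) (residue-of-block k x)) (t-block k x k<4)

-- The weight 2a - b - c in which S_{3,0}(4x) combines the three classes.
Δ : ℤ → ℤ → ℤ → ℤ
Δ a b c = (+ 2) * a - b - c

Δ-cong : ∀ {a a′ b b′ c c′} → a ≡ a′ → b ≡ b′ → c ≡ c′ → Δ a b c ≡ Δ a′ b′ c′
Δ-cong refl refl refl = refl

Δ-additive : ∀ a b c a′ b′ c′ → Δ a b c + Δ a′ b′ c′ ≡ Δ (a + a′) (b + b′) (c + c′)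
Δ-additive = expanded
  where
  expanded : ∀ a b c a′ b′ c′ →
    ((+ 2) * a - b - c) + ((+ 2) * a′ - b′ - c′) ≡ (+ 2) * (a + a′) - (b + b′) - (c + c′)
  expanded = ℤ-Ring.solve-∀

-- The heart of the argument: the signs (+1, -1, -1, +1) of the block, placed
-- in the residue classes c, c+1, c+2, c (mod 3), meet class 0 with total
-- weight 2[c = 0] - [c = 1] - [c = 2].
class-balance : ∀ c → c < 3 →
  indicator 0 ((0 +ℕ c) % 3) * t 0 + indicator 0 ((1 +ℕ c) % 3) * t 1
    + indicator 0 ((2 +ℕ c) % 3) * t 2 + indicator 0 ((3 +ℕ c) % 3) * t 3
  ≡ Δ (indicator 0 c) (indicator 1 c) (indicator 2 c)
class-balance 0 _ = refl
class-balance 1 _ = refl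
class-balance 2 _ = refl
class-balance (suc (suc (suc _))) (s≤s (s≤s (s≤s ())))

block-weight : ∀ x →
  term 0 (x *ℕ 4) + term 0 (1 +ℕ x *ℕ 4) + term 0 (2 +ℕ x *ℕ 4) + term 0 (3 +ℕ x *ℕ 4)
  ≡ Δ (term 0 x) (term 1 x) (term 2 x)
block-weight x = begin
  term 0 (x *ℕ 4) + term 0 (1 +ℕ x *ℕ 4) + term 0 (2 +ℕ x *ℕ 4) + term 0 (3 +ℕ x *ℕ 4)
    ≡⟨ cong₂ _+_ (cong₂ _+_ (cong₂ _+_ (term-in-block 0 0 x z<s) (term-in-block 0 1 x (s<s z<s)))
                              (term-in-block 0 2 x (s<s (s<s z<s))))
                 (term-in-block 0 3 x ≤-refl) ⟩
  a 0 * (t 0 * t x) + a 1 * (t 1 * t x) + a 2 * (t 2 * t x) + a 3 * (t 3 * t x)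
    ≡⟨ factor (a 0) (a 1) (a 2) (a 3) (t 0) (t 1) (t 2) (t 3) (t x) ⟩
  (a 0 * t 0 + a 1 * t 1 + a 2 * t 2 + a 3 * t 3) * t x
    ≡⟨ cong (_* t x) (class-balance (x % 3) (m%n<n x 3)) ⟩
  Δ (indicator 0 (x % 3)) (indicator 1 (x % 3)) (indicator 2 (x % 3)) * t x
    ≡⟨ distribute (indicator 0 (x % 3)) (indicator 1 (x % 3)) (indicator 2 (x % 3)) (t x) ⟩
  Δ (term 0 x) (term 1 x) (term 2 x) ∎
  where
  open ≡-Reasoning
  a : ℕ → ℤ
  a k = indicator 0 ((k +ℕ x % 3) % 3)
  factor : ∀ a₀ a₁ a₂ a₃ σ₀ σ₁ σ₂ σ₃ v →
    a₀ * (σ₀ * v) + a₁ * (σ₁ * v) + a₂ * (σ₂ * v) + a₃ * (σ₃ * v) ≡ (a₀ * σ₀ + a₁ * σ₁ + a₂ * σ₂ + a₃ * σ₃) * v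
  factor = ℤ-Ring.solve-∀
  distribute : ∀ i₀ i₁ i₂ v → ((+ 2) * i₀ - i₁ - i₂) * v ≡ (+ 2) * (i₀ * v) - i₁ * v - i₂ * v
  distribute = ℤ-Ring.solve-∀

Snj-suc : ∀ j r → Snj 1 j (suc r) ≡ Snj 1 j r + term j r
Snj-suc j r = S-suc 3 2 j r

block-sum : ∀ j x → Snj 1 j (suc x *ℕ 4) ≡
  Snj 1 j (x *ℕ 4) + (term j (x *ℕ 4) + term j (1 +ℕ x *ℕ 4) + term j (2 +ℕ x *ℕ 4) + term j (3 +ℕ x *ℕ 4))
block-sum j x = begin
  Snj 1 j (4 +ℕ y)                                                        ≡⟨ Snj-suc j (3 +ℕ y) ⟩
  Snj 1 j (3 +ℕ y) + term j (3 +ℕ y)                                      ≡⟨ cong (_+ term j (3 +ℕ y)) (Snj-suc j (2 +ℕ y)) ⟩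
  Snj 1 j (2 +ℕ y) + term j (2 +ℕ y) + term j (3 +ℕ y)                    ≡⟨ cong (λ v → v + term j (2 +ℕ y) + term j (3 +ℕ y)) (Snj-suc j (1 +ℕ y)) ⟩
  Snj 1 j (1 +ℕ y) + term j (1 +ℕ y) + term j (2 +ℕ y) + term j (3 +ℕ y)  ≡⟨ cong (λ v → v + term j (1 +ℕ y) + term j (2 +ℕ y) + term j (3 +ℕ y)) (Snj-suc j y) ⟩
  Snj 1 j y + term j y + term j (1 +ℕ y) + term j (2 +ℕ y) + term j (3 +ℕ y)
    ≡⟨ reassoc (Snj 1 j y) (term j y) (term j (1 +ℕ y)) (term j (2 +ℕ y)) (term j (3 +ℕ y)) ⟩
  Snj 1 j y + (term j y + term j (1 +ℕ y) + term j (2 +ℕ y) + term j (3 +ℕ y)) ∎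
  where
  open ≡-Reasoning
  y : ℕ
  y = x *ℕ 4
  reassoc : ∀ a b c d e → a + b + c + d + e ≡ a + (b + c + d + e)
  reassoc = ℤ-Ring.solve-∀

S-quadruple : ∀ x → Snj 1 0 (x *ℕ 4) ≡ Δ (Snj 1 0 x) (Snj 1 1 x) (Snj 1 2 x)
S-quadruple zero    = refl
S-quadruple (suc x) = begin
  Snj 1 0 (suc x *ℕ 4)
    ≡⟨ block-sum 0 x ⟩
  Snj 1 0 (x *ℕ 4) + (term 0 (x *ℕ 4) + term 0 (1 +ℕ x *ℕ 4) + term 0 (2 +ℕ x *ℕ 4) + term 0 (3 +ℕ x *ℕ 4))
    ≡⟨ cong₂ _+_ (S-quadruple x) (block-weight x) ⟩
  Δ (Snj 1 0 x) (Snj 1 1 x) (Snj 1 2 x) + Δ (term 0 x) (term 1 x) (term 2 x)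
    ≡⟨ Δ-additive (Snj 1 0 x) (Snj 1 1 x) (Snj 1 2 x) (term 0 x) (term 1 x) (term 2 x) ⟩
  Δ (Snj 1 0 x + term 0 x) (Snj 1 1 x + term 1 x) (Snj 1 2 x + term 2 x)
    ≡⟨ sym (Δ-cong (Snj-suc 0 x) (Snj-suc 1 x) (Snj-suc 2 x)) ⟩
  Δ (Snj 1 0 (suc x)) (Snj 1 1 (suc x)) (Snj 1 2 (suc x)) ∎
  where open ≡-Reasoning

-- The theorem follows by substituting the key identity (it holds for x = 0 too).
mainTheorem1 : (x : ℕ) → x ≥ 1 →
    (+ 3) * Snj 1 0 x - Snj 1 0 (4 *ℕ x) ≡ Snj 1 0 x + Snj 1 1 x + Snj 1 2 x
mainTheorem1 x _ = begin
  (+ 3) * S₀ - Snj 1 0 (4 *ℕ x)  ≡⟨ cong (λ y → (+ 3) * S₀ - Snj 1 0 y) (*-comm 4 x) ⟩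
  (+ 3) * S₀ - Snj 1 0 (x *ℕ 4)  ≡⟨ cong (λ v → (+ 3) * S₀ - v) (S-quadruple x) ⟩
  (+ 3) * S₀ - Δ S₀ S₁ S₂        ≡⟨ cancel S₀ S₁ S₂ ⟩
  S₀ + S₁ + S₂                   ∎
  where
  open ≡-Reasoning
  S₀ S₁ S₂ : ℤ
  S₀ = Snj 1 0 x
  S₁ = Snj 1 1 x
  S₂ = Snj 1 2 x
  cancel : ∀ a b c → (+ 3) * a - ((+ 2) * a - b - c) ≡ a + b + c
  cancel = ℤ-Ring.solve-∀
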